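{- For all integers $n\ge 0$, \[ a^{ -\{1,2\}}_{4,1}(n)= a^{ -\{1,2\}}_{4,3}(n). \]
   Context: A partition of $n$ is a non-increasing sequence of positive integers summing to $n$; its Young diagram is the left-justified array of boxes whose $i$-th row has $\lambda_i$ boxes. The hook length of a box is the number of boxes directly to its right, plus the number directly below it, plus $1$; a box of hook length $k$ is a $k$-hook. For $t\ge 2$, a $t$-core partition is a partition none of whose hook lengths is divisible by $t$. For a set $C$ of positive integers, $a^{ -C}_{t,k}(n)$ denotes the total number of hooks of length $k$ summed over all $t$-core partitions of $n$ none of whose parts belongs to $C$. -}

module Defs where

open import Data.Nat using (ℕ; zero; suc; _+_; _∸_; _≤_; _<_; _≥_; _≟_; _<?_; _≥?_; _≤?_)
open import Data.Nat.Divisibility using (_∣_; _∣?_)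
open import Data.List using (List; []; _∷_; _++_; map; concatMap; filter; length; upTo)
open import Data.Nat.ListAction using (sum)
open import Data.List.Relation.Unary.All using (All; all?)
open import Data.List.Relation.Unary.Linked using (Linked; linked?)
open import Data.List.Membership.Propositional using (_∉_)
open import Data.List.Membership.DecPropositional _≟_ using (_∈?_)
open import Data.Product using (_×_)
open import Relation.Nullary using (¬_; Dec)
open import Relation.Nullary.Decidable using (_×-dec_; ¬?)
open import Relation.Binary.PropositionalEquality using (_≡_)

IsPartition : ℕ → List ℕ → Set
IsPartition n λs = Linked _≥_ λs × All (λ p → 1 ≤ p) λs × sum λs ≡ n

isPartition? : ∀ n λs → Dec (IsPartition n λs)
isPartition? n λs = linked? _≥?_ λs ×-dec (all? (λ p → 1 ≤? p) λs ×-dec (sum λs ≟ n))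

-- Candidate lists: non-increasing lists of parts in {1,…,m} summing to n
-- (generated with fuel f; fuel n suffices since every part is ≥ 1).
candidates : ℕ → ℕ → ℕ → List (List ℕ)
candidates f m zero = [] ∷ []
candidates zero m (suc n) = []
candidates (suc f) m (suc n) =
  concatMap (λ k → map (suc k ∷_) (candidates f (suc k) (suc n ∸ suc k)))
            (filter (λ k → suc k ≤? m) (upTo (suc n)))

partitions : ℕ → List (List ℕ)
partitions n = filter (isPartition? n) (candidates n n n)

leg : ℕ → List ℕ → ℕ
leg j rows = length (filter (j <?_) rows)

-- Multiset (list) of hook lengths of all boxes of the Young diagram,
-- box (i,j) (0-based) has hook = arm + leg + 1, arm = λ_i - j - 1.
hooks : List ℕ → List ℕ
hooks [] = []
hooks (r ∷ rest) = map (λ j → (r ∸ suc j) + leg j rest + 1) (upTo r) ++ hooks rest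

IsCore : ℕ → List ℕ → Set
IsCore t λs = All (λ h → ¬ (t ∣ h)) (hooks λs)

isCore? : ∀ t λs → Dec (IsCore t λs)
isCore? t λs = all? (λ h → ¬? (t ∣? h)) (hooks λs)

AvoidsParts : List ℕ → List ℕ → Set
AvoidsParts C λs = All (λ p → p ∉ C) λs

avoidsParts? : ∀ C λs → Dec (AvoidsParts C λs)
avoidsParts? C λs = all? (λ p → ¬? (p ∈? C)) λs

numHooks : ℕ → List ℕ → ℕ
numHooks k λs = length (filter (k ≟_) (hooks λs))

-- a^{-C}_{t,k}(n): total number of k-hooks over all t-core partitions of n
-- with no part in C.
a : List ℕ → ℕ → ℕ → ℕ → ℕ
a C t k n = sum (map (numHooks k)
  (filter (λ λs → isCore? t λs ×-dec avoidsParts? C λs) (partitions n)))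

-- A 4-core none of whose parts is 1 or 2 must be a staircase (3k, 3k-3, …, 6, 3):
-- reading the rows from the bottom, a row of length r ≠ 3k + 3 on top of the
-- staircase of height k always contains a box with arm + leg = 3.
-- In the top row of the staircase of height k + 1 the last three boxes have
-- hook lengths 3, 2, 1 and every other box has arm ≥ 3 and leg ≥ 1, so the
-- staircase of height k has exactly k hooks of each length 1, 2 and 3.
module Submission where

open import Defs
open import Data.Nat using (ℕ; zero; suc; _+_; _*_; _∸_; _≤_; _<_; _≥_; _≟_; _<?_; z≤n; s≤s)
open import Data.Nat.Properties
open import Data.Nat.Divisibility using (_∣_; ∣-refl)
open import Data.Nat.ListAction using (sum)
open import Data.List using (List; []; _∷_; _++_; map; filter; length; upTo; applyUpTo)
open import Data.List.Properties using (filter-++; length-++; filter-none; filter-accept; filter-reject; map-upTo; map-cong-local)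
open import Data.List.Relation.Unary.All using (All; []; _∷_)
import Data.List.Relation.Unary.All as All
open import Data.List.Relation.Unary.All.Properties using (++⁻ʳ; applyUpTo⁺₁)
open import Data.List.Relation.Unary.Any using (here; there)
open import Data.List.Relation.Unary.Linked using (Linked) renaming (head to Linked-head; tail to Linked-tail)
open import Data.List.Membership.Propositional using (_∈_; _∉_)
open import Data.List.Membership.Propositional.Properties using (∈-++⁺ˡ; ∈-map⁺; ∈-upTo⁺; ∈-filter⁻)
open import Data.Product using (∃-syntax; _×_; _,_; proj₂)
open import Data.Empty using (⊥-elim)
open import Relation.Nullary using (¬_)
open import Relation.Binary.PropositionalEquality using (_≡_; refl; sym; trans; cong; cong₂; subst; module ≡-Reasoning)

applyUpTo-3+ : ∀ {A : Set} (f : ℕ → A) n →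
               applyUpTo f (3 + n) ≡ applyUpTo f n ++ f n ∷ f (1 + n) ∷ f (2 + n) ∷ []
applyUpTo-3+ f zero    = refl
applyUpTo-3+ f (suc n) = cong (f 0 ∷_) (applyUpTo-3+ (λ i → f (suc i)) n)

count : ℕ → List ℕ → ℕ
count c xs = length (filter (c ≟_) xs)

count-++ : ∀ c xs ys → count c (xs ++ ys) ≡ count c xs + count c ys
count-++ c xs ys = trans (cong length (filter-++ (c ≟_) xs ys)) (length-++ (filter (c ≟_) xs))

count-<-≡0 : ∀ {c xs} → All (c <_) xs → count c xs ≡ 0
count-<-≡0 {c} c<xs = cong length (filter-none (c ≟_) (All.map <⇒≢ c<xs))

count-321 : ∀ {c} → 1 ≤ c → c ≤ 3 → count c (3 ∷ 2 ∷ 1 ∷ []) ≡ 1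
count-321 {1} _ _ = refl
count-321 {2} _ _ = refl
count-321 {3} _ _ = refl
count-321 {suc (suc (suc (suc _)))} _ (s≤s (s≤s (s≤s ())))

hookAt : ℕ → List ℕ → ℕ → ℕ
hookAt r rest j = (r ∸ suc j) + leg j rest + 1

hookAt-∈-hooks : ∀ {r j} rest → j < r → hookAt r rest j ∈ hooks (r ∷ rest)
hookAt-∈-hooks {r} rest j<r = ∈-++⁺ˡ (∈-map⁺ (hookAt r rest) (∈-upTo⁺ j<r))

hookAt-arm : ∀ arm j rest → hookAt (suc (arm + j)) rest j ≡ arm + leg j rest + 1
hookAt-arm arm j rest = cong (λ a → a + leg j rest + 1) (m+n∸n≡m arm j)

arm+leg≡3⇒¬IsCore4 : ∀ arm j rest → arm + leg j rest ≡ 3 → ¬ IsCore 4 (suc (arm + j) ∷ rest)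
arm+leg≡3⇒¬IsCore4 arm j rest arm+leg≡3 core =
  All.lookup core (hookAt-∈-hooks rest (s≤s (m≤n+m j arm)))
    (subst (4 ∣_) (sym (trans (hookAt-arm arm j rest) (cong (_+ 1) arm+leg≡3))) ∣-refl)

IsCore-tail : ∀ {t r} rest → IsCore t (r ∷ rest) → IsCore t rest
IsCore-tail {r = r} rest = ++⁻ʳ (map (hookAt r rest) (upTo r))

staircase : ℕ → List ℕ
staircase zero    = []
staircase (suc k) = suc k * 3 ∷ staircase k

leg-staircase-≥ : ∀ {j} k → k * 3 ≤ j → leg j (staircase k) ≡ 0
leg-staircase-≥ zero    _     = refl
leg-staircase-≥ {j} (suc k) 3k+3≤j = begin
  length (filter (j <?_) (suc k * 3 ∷ staircase k)) ≡⟨ cong length (filter-reject (j <?_) (≤⇒≯ 3k+3≤j)) ⟩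
  leg j (staircase k)                               ≡⟨ leg-staircase-≥ k (≤-trans (m≤n+m (k * 3) 3) 3k+3≤j) ⟩
  0                                                 ∎
  where open ≡-Reasoning

leg-staircase-top : ∀ {j} k → k * 3 ≤ j → j < suc k * 3 → leg j (staircase (suc k)) ≡ 1
leg-staircase-top {j} k 3k≤j j<3k+3 =
  trans (cong length (filter-accept (j <?_) j<3k+3)) (cong suc (leg-staircase-≥ k 3k≤j))

leg-staircase-< : ∀ {j} k → j < k * 3 → 1 ≤ leg j (staircase k)
leg-staircase-< {j} (suc k) j<3k+3 rewrite filter-accept (j <?_) {xs = staircase k} j<3k+3 = s≤s z≤n

staircase-head-≤ : ∀ {r} k → Linked _≥_ (r ∷ staircase k) → k * 3 ≤ r
staircase-head-≤ zero    _      = z≤n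
staircase-head-≤ (suc k) linked = Linked-head linked

-- On top of the staircase of height k, a row of length 3k + d with d ≤ 2 (k > 0) has a box
-- with arm 2 and leg 1, and one with d ≥ 4 has a box with arm 3 and leg 0.
¬IsCore4-short-row : ∀ d k → d < 3 → ¬ IsCore 4 (suc (2 + (d + k * 3)) ∷ staircase (suc k))
¬IsCore4-short-row d k d<3 = arm+leg≡3⇒¬IsCore4 2 (d + k * 3) (staircase (suc k))
  (cong (2 +_) (leg-staircase-top k (m≤n+m (k * 3) d) (+-monoˡ-< (k * 3) d<3)))

¬IsCore4-long-row : ∀ d k → ¬ IsCore 4 (4 + d + k * 3 ∷ staircase k)
¬IsCore4-long-row d k = arm+leg≡3⇒¬IsCore4 3 (d + k * 3) (staircase k)
  (cong (3 +_) (leg-staircase-≥ k (m≤n+m (k * 3) d)))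

excess-over-staircase≡3 : ∀ d k → 1 ≤ d + k * 3 → d + k * 3 ∉ 1 ∷ 2 ∷ [] →
                          IsCore 4 (d + k * 3 ∷ staircase k) → d ≡ 3
excess-over-staircase≡3 0 zero    () _ _
excess-over-staircase≡3 1 zero    _ avoid _ = ⊥-elim (avoid (here refl))
excess-over-staircase≡3 2 zero    _ avoid _ = ⊥-elim (avoid (there (here refl)))
excess-over-staircase≡3 0 (suc k) _ _ core = ⊥-elim (¬IsCore4-short-row 0 k (s≤s z≤n) core)
excess-over-staircase≡3 1 (suc k) _ _ core = ⊥-elim (¬IsCore4-short-row 1 k (s≤s (s≤s z≤n)) core)
excess-over-staircase≡3 2 (suc k) _ _ core = ⊥-elim (¬IsCore4-short-row 2 k ≤-refl core)
excess-over-staircase≡3 3 k _ _ _ = refl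
excess-over-staircase≡3 (suc (suc (suc (suc d)))) k _ _ core = ⊥-elim (¬IsCore4-long-row d k core)

top-row-over-staircase : ∀ {r} k → Linked _≥_ (r ∷ staircase k) → 1 ≤ r → r ∉ 1 ∷ 2 ∷ [] →
                         IsCore 4 (r ∷ staircase k) → r ≡ suc k * 3
top-row-over-staircase k linked 1≤r avoid core
  with d , refl ← m≤n⇒∃[o]m+o≡n (staircase-head-≤ k linked)
  rewrite +-comm (k * 3) d
  with refl ← excess-over-staircase≡3 d k 1≤r avoid core = refl

4-core-without-1-2⇒staircase : ∀ λs → Linked _≥_ λs → All (1 ≤_) λs → AvoidsParts (1 ∷ 2 ∷ []) λs →
                      IsCore 4 λs → ∃[ k ] λs ≡ staircase k
4-core-without-1-2⇒staircase []         _      _           _               _    = 0 , refl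
4-core-without-1-2⇒staircase (r ∷ rest) linked (1≤r ∷ pos) (avoid ∷ avoids) core
  with k , refl ← 4-core-without-1-2⇒staircase rest (Linked-tail linked) pos avoids (IsCore-tail rest core)
  = suc k , cong (_∷ staircase k) (top-row-over-staircase k linked 1≤r avoid core)

hookAt-staircase-beyond : ∀ arm {j} k → k * 3 ≤ j → hookAt (suc (arm + j)) (staircase k) j ≡ suc arm
hookAt-staircase-beyond arm {j} k 3k≤j = begin
  hookAt (suc (arm + j)) (staircase k) j ≡⟨ hookAt-arm arm j (staircase k) ⟩
  arm + leg j (staircase k) + 1          ≡⟨ cong (λ l → arm + l + 1) (leg-staircase-≥ k 3k≤j) ⟩
  arm + 0 + 1                            ≡⟨ cong (_+ 1) (+-identityʳ arm) ⟩
  arm + 1                                ≡⟨ +-comm arm 1 ⟩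
  suc arm                                ∎
  where open ≡-Reasoning

5≤hookAt-staircase : ∀ {j} k → j < k * 3 → 5 ≤ hookAt (suc k * 3) (staircase k) j
5≤hookAt-staircase {j} k j<3k = +-monoˡ-≤ 1 (+-mono-≤ 3≤arm (leg-staircase-< k j<3k))
  where
    3≤arm : 3 ≤ suc k * 3 ∸ suc j
    3≤arm = ≤-trans (m≤m+n 3 (k * 3 ∸ suc j)) (≤-reflexive (sym (+-∸-assoc 3 j<3k)))

hooks-staircase-suc : ∀ k → hooks (staircase (suc k))
                          ≡ (applyUpTo (hookAt (suc k * 3) (staircase k)) (k * 3) ++ 3 ∷ 2 ∷ 1 ∷ [])
                            ++ hooks (staircase k)
hooks-staircase-suc k = cong (_++ hooks (staircase k)) (begin
  map h (upTo (3 + x))                             ≡⟨ map-upTo h (3 + x) ⟩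
  applyUpTo h (3 + x)                              ≡⟨ applyUpTo-3+ h x ⟩
  applyUpTo h x ++ h x ∷ h (1 + x) ∷ h (2 + x) ∷ [] ≡⟨ cong (applyUpTo h x ++_) last-three ⟩
  applyUpTo h x ++ 3 ∷ 2 ∷ 1 ∷ []                  ∎)
  where
    open ≡-Reasoning
    x = k * 3
    h = hookAt (suc k * 3) (staircase k)
    last-three : h x ∷ h (1 + x) ∷ h (2 + x) ∷ [] ≡ 3 ∷ 2 ∷ 1 ∷ []
    last-three = cong₂ _∷_ (hookAt-staircase-beyond 2 k ≤-refl)
                (cong₂ _∷_ (hookAt-staircase-beyond 1 k (m≤n+m x 1))
                (cong₂ _∷_ (hookAt-staircase-beyond 0 k (m≤n+m x 2)) refl))

numHooks-staircase : ∀ {c} → 1 ≤ c → c ≤ 3 → ∀ k → numHooks c (staircase k) ≡ k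
numHooks-staircase         _   _   zero    = refl
numHooks-staircase {c} 1≤c c≤3 (suc k) = begin
  numHooks c (staircase (suc k))                                 ≡⟨ cong (count c) (hooks-staircase-suc k) ⟩
  count c ((large ++ 3 ∷ 2 ∷ 1 ∷ []) ++ hooks (staircase k))       ≡⟨ count-++ c (large ++ _) _ ⟩
  count c (large ++ 3 ∷ 2 ∷ 1 ∷ []) + numHooks c (staircase k)      ≡⟨ cong (_+ numHooks c (staircase k)) (count-++ c large _) ⟩
  count c large + count c (3 ∷ 2 ∷ 1 ∷ []) + numHooks c (staircase k)
    ≡⟨ cong₂ _+_ (cong₂ _+_ (count-<-≡0 c<large) (count-321 1≤c c≤3)) (numHooks-staircase 1≤c c≤3 k) ⟩
  suc k                                                          ∎
  where
    open ≡-Reasoning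
    large = applyUpTo (hookAt (suc k * 3) (staircase k)) (k * 3)
    c<large : All (c <_) large
    c<large = applyUpTo⁺₁ _ (k * 3) (λ j<3k → ≤-trans (s≤s (m≤n⇒m≤1+n c≤3)) (5≤hookAt-staircase k j<3k))

numHooks-1≡3-of-core : ∀ {n λs} → IsPartition n λs → IsCore 4 λs × AvoidsParts (1 ∷ 2 ∷ []) λs →
                       numHooks 1 λs ≡ numHooks 3 λs
numHooks-1≡3-of-core {λs = λs} (linked , positive , _) (core , avoids)
  with k , refl ← 4-core-without-1-2⇒staircase λs linked positive avoids core
  = trans (numHooks-staircase ≤-refl (s≤s z≤n) k) (sym (numHooks-staircase (s≤s z≤n) ≤-refl k))

theorem1p6 : (n : ℕ) → a (1 ∷ 2 ∷ []) 4 1 n ≡ a (1 ∷ 2 ∷ []) 4 3 n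
theorem1p6 n = cong sum (map-cong-local (All.tabulate λ λs∈ →
  let λs∈partitions , core-without-1-2 = ∈-filter⁻ _ {xs = partitions n} λs∈
  in numHooks-1≡3-of-core (proj₂ (∈-filter⁻ (isPartition? n) {xs = candidates n n n} λs∈partitions))
                          core-without-1-2))
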